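{- For integers $n \geq r \geq 6$, $rsat(n,C_r) \geq \frac{6}{5}n$.
   Context: All graphs are finite, simple and undirected. An edge-coloring of a graph $G$ is a function $\mathcal{C}:E(G)\to\mathbb{N}$; a (sub)graph is rainbow if all its edges have distinct colors. An edge-colored graph $G$ is $F$-rainbow saturated if it contains no rainbow copy of $F$ but adding any nonedge of $G$ with any color on it creates a rainbow copy of $F$. $rsat(n,F)$ is the minimum number of edges of a graph on $n$ vertices admitting an edge-coloring that makes it $F$-rainbow saturated. $C_r$ is the cycle on $r$ vertices. -}

module Defs where

open import Data.Nat using (ℕ; zero; suc; _%_; _<ᵇ_)
open import Data.Nat.DivMod using (m%n<n)
open import Data.Nat.ListAction using (sum)
open import Data.Fin using (Fin; toℕ; fromℕ<; _≟_)
open import Data.Bool using (Bool; true; false; T; _∧_; _∨_; if_then_else_)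
open import Data.List using (map; allFin)
open import Data.Product using (Σ; _×_)
open import Function.Definitions using (Injective)
open import Relation.Binary.PropositionalEquality using (_≡_; _≢_)
open import Relation.Nullary using (¬_)
open import Relation.Nullary.Decidable using (⌊_⌋)

record SimpleGraph (n : ℕ) : Set where
  field
    adj    : Fin n → Fin n → Bool
    sym    : ∀ i j → adj i j ≡ adj j i
    irrefl : ∀ i → adj i i ≡ false
open SimpleGraph public

numEdges : ∀ {n} → SimpleGraph n → ℕ
numEdges {n} G =
  sum (map (λ i → sum (map (λ j → if (toℕ i <ᵇ toℕ j) ∧ adj G i j then 1 else 0)
                            (allFin n)))
           (allFin n))

-- An edge-coloring: a color in ℕ for each (unordered) pair; only the values on
-- edges matter, and symmetry is required separately.
Coloring : ℕ → Set
Coloring n = Fin n → Fin n → ℕ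

SymmetricColoring : ∀ {n} → Coloring n → Set
SymmetricColoring c = ∀ i j → c i j ≡ c j i

sucMod : ∀ {m} → Fin (suc m) → Fin (suc m)
sucMod {m} i = fromℕ< (m%n<n (suc (toℕ i)) (suc m))

HasRainbowCycle : ∀ {n} (m : ℕ) → (Fin n → Fin n → Bool) → Coloring n → Set
HasRainbowCycle {n} m a c =
  Σ (Fin (suc m) → Fin n) λ f →
    Injective _≡_ _≡_ f
    × (∀ i → T (a (f i) (f (sucMod i))))
    × Injective _≡_ _≡_ (λ i → c (f i) (f (sucMod i)))

samePair : ∀ {n} → Fin n → Fin n → Fin n → Fin n → Bool
samePair u v x y = (⌊ x ≟ u ⌋ ∧ ⌊ y ≟ v ⌋) ∨ (⌊ x ≟ v ⌋ ∧ ⌊ y ≟ u ⌋)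

addEdge : ∀ {n} → (Fin n → Fin n → Bool) → Fin n → Fin n → Fin n → Fin n → Bool
addEdge a u v x y = a x y ∨ samePair u v x y

addColor : ∀ {n} → Coloring n → Fin n → Fin n → ℕ → Coloring n
addColor c u v k x y = if samePair u v x y then k else c x y

RainbowSaturated : ∀ {n} (m : ℕ) → SimpleGraph n → Coloring n → Set
RainbowSaturated m G c =
  ¬ HasRainbowCycle m (adj G) c
  × (∀ u v → u ≢ v → adj G u v ≡ false → ∀ (k : ℕ) →
       HasRainbowCycle m (addEdge (adj G) u v) (addColor c u v k))

-- Saturation yields an escape property: for every non-edge uv and every colour k, the rainbow C_r
-- created by adding uv with colour k leaves u along a path u p₂ p₃ p₄ of G whose first edge is not
-- coloured k (this only needs r ≥ 5). Playing such paths against small neighbourhoods shows that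
-- every vertex has degree at least 2, two adjacent vertices of degree 2 lie on a triangle, no
-- vertex of degree 2 has two neighbours of degree 2, and no vertex of degree 3 is adjacent to two
-- adjacent vertices of degree 2 (n ≥ 4). Now discharge: every edge carries 10, split between its
-- ends. A degree-2 vertex takes 6 from an edge to a vertex of other degree, or 7 if its other
-- neighbour has degree 2 (and that edge is split 5 + 5). A vertex of degree 3 then gets at least
-- 4 from every edge and any vertex at least 3, so every vertex collects at least 12, and
-- 12 n ≤ 10 |E|.

module Submission where

open import Defs renaming (sym to adj-sym)
open import Data.Nat as ℕ using (ℕ; zero; suc; _+_; _*_; _∸_; _≤_; _<_; _≤ᵇ_; _<ᵇ_; z≤n; s≤s; _%_; _/_; NonZero)
open import Data.Nat.Properties hiding (_≟_)
open import Data.Nat.DivMod using (m%n<n; m≡m%n+[m/n]*n; [m+n]%n≡m%n; [m+kn]%n≡m%n; m<n⇒m%n≡m; /-monoˡ-≤)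
open import Data.Nat.ListAction using (sum)
open import Data.Fin using (Fin; zero; suc; toℕ; fromℕ<; _≟_)
open import Data.Fin.Properties using (toℕ-injective; toℕ-fromℕ<; toℕ<n; any?; injective⇒≤)
open import Data.Bool using (Bool; true; false; T; _∧_; _∨_; if_then_else_)
open import Data.Bool.Properties using (T-∨; T-∧; ∨-comm; ∧-comm; ∨-zeroʳ; ¬-not; T-≡)
open import Data.Bool.ListAction using (any)
open import Data.List using (List; []; _∷_; length; lookup; map; filterᵇ; allFin; tabulate)
open import Data.List.Properties using (length-tabulate; map-tabulate)
open import Data.List.Membership.Propositional using (_∈_; _∉_; find)
open import Data.List.Membership.Propositional.Properties using (∈-lookup; ∈-filter⁺; ∈-filter⁻; ∈-allFin)
open import Data.List.Relation.Binary.Subset.Propositional using (_⊆_)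
open import Data.List.Relation.Unary.All as All using (All; []; _∷_; all?)
open import Data.List.Relation.Unary.All.Properties using (¬Any⇒All¬; ¬All⇒Any¬)
open import Data.List.Relation.Unary.Any using (here; there; index)
open import Data.List.Relation.Unary.Any.Properties using (lookup-index; any⁻)
open import Data.List.Relation.Unary.Unique.Propositional using (Unique; []; _∷_)
open import Data.List.Relation.Unary.Unique.Propositional.Properties using (tabulate⁺; filter⁺; allFin⁺)
open import Data.Product using (∃; _×_; _,_; proj₁; proj₂)
open import Data.Sum using (_⊎_; inj₁; inj₂)
open import Data.Empty using (⊥; ⊥-elim)
open import Data.Unit using (tt)
open import Function using (_∘_; id; Equivalence)
open import Function.Definitions using (Injective)
open import Relation.Binary.Definitions using (DecidableEquality; tri<; tri≈; tri>)
open import Relation.Binary.PropositionalEquality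
open import Relation.Nullary using (¬_; yes; no)
open import Relation.Nullary.Decidable using (⌊_⌋; toWitness; T?)
open import Algebra.Properties.CommutativeSemigroup +-commutativeSemigroup using (xy∙z≈xz∙y)
open import Algebra.Properties.Semiring.Sum +-*-semiring using (sum-syntax; ∑-comm; ∑-distrib-+; *-distribˡ-sum; sum-cong-≗)

module _ {a} {A : Set a} where

  lookup-injective : ∀ {xs : List A} → Unique xs → Injective _≡_ _≡_ (lookup xs)
  lookup-injective {x ∷ xs} _          {zero}  {zero}  _  = refl
  lookup-injective {x ∷ xs} (x∉xs ∷ _) {zero}  {suc j} eq = ⊥-elim (All.lookup x∉xs (∈-lookup j) eq)
  lookup-injective {x ∷ xs} (x∉xs ∷ _) {suc i} {zero}  eq = ⊥-elim (All.lookup x∉xs (∈-lookup i) (sym eq))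
  lookup-injective {x ∷ xs} (_ ∷ xs!)  {suc i} {suc j} eq = cong suc (lookup-injective xs! eq)

  Unique⇒length≤ : ∀ {xs ys : List A} → Unique xs → xs ⊆ ys → length xs ≤ length ys
  Unique⇒length≤ {xs} {ys} xs! xs⊆ys = injective⇒≤ position-injective
    where
    position : Fin (length xs) → Fin (length ys)
    position i = index (xs⊆ys (∈-lookup i))
    position-injective : Injective _≡_ _≡_ position
    position-injective {i} {j} eq = lookup-injective xs! (begin
      lookup xs i            ≡⟨ lookup-index (xs⊆ys (∈-lookup i)) ⟩
      lookup ys (position i) ≡⟨ cong (lookup ys) eq ⟩
      lookup ys (position j) ≡⟨ sym (lookup-index (xs⊆ys (∈-lookup j))) ⟩
      lookup xs j            ∎)
      where open ≡-Reasoning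

module _ {a} {A : Set a} (_≟_ : DecidableEquality A) where
  open import Data.List.Membership.DecPropositional _≟_ using (_∈?_)

  ∃∈∉ : ∀ {xs ys : List A} → Unique xs → length ys < length xs → ∃ λ x → x ∈ xs × x ∉ ys
  ∃∈∉ {xs} {ys} xs! ys<xs with all? (_∈? ys) xs
  ... | yes xs⊆ys = ⊥-elim (<⇒≱ ys<xs (Unique⇒length≤ xs! (All.lookup xs⊆ys)))
  ... | no xs⊈ys  = find (¬All⇒Any¬ (_∈? ys) xs xs⊈ys)

  ⊆-by-length : ∀ {xs ys : List A} → Unique ys → ys ⊆ xs → length xs ≤ length ys → xs ⊆ ys
  ⊆-by-length {xs} {ys} ys! ys⊆xs xs≤ys {x} x∈xs with x ∈? ys
  ... | yes x∈ys = x∈ys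
  ... | no x∉ys  = ⊥-elim (<⇒≱ (Unique⇒length≤ (¬Any⇒All¬ ys x∉ys ∷ ys!) x∷ys⊆xs) xs≤ys)
    where
    x∷ys⊆xs : x ∷ ys ⊆ xs
    x∷ys⊆xs (here refl) = x∈xs
    x∷ys⊆xs (there y∈ys) = ys⊆xs y∈ys

∈-swap : ∀ {a} {A : Set a} {x y z : A} {xs} → x ∈ y ∷ z ∷ xs → x ∈ z ∷ y ∷ xs
∈-swap (here x≡y)         = there (here x≡y)
∈-swap (there (here x≡z)) = here x≡z
∈-swap (there (there x∈)) = there (there x∈)

sum-map-≥ : ∀ {a} {A : Set a} (g : A → ℕ) {k} {xs : List A} →
            (∀ {x} → x ∈ xs → k ≤ g x) → length xs * k ≤ sum (map g xs)
sum-map-≥ g {xs = []}     _   = z≤n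
sum-map-≥ g {xs = x ∷ xs} k≤g = +-mono-≤ (k≤g (here refl)) (sum-map-≥ g (k≤g ∘ there))

sum-map-filterᵇ : ∀ {a} {A : Set a} (p : A → Bool) (g : A → ℕ) xs →
                  sum (map g (filterᵇ p xs)) ≡ sum (map (λ x → if p x then g x else 0) xs)
sum-map-filterᵇ p g []       = refl
sum-map-filterᵇ p g (x ∷ xs) with p x
... | true  = cong (g x +_) (sum-map-filterᵇ p g xs)
... | false = sum-map-filterᵇ p g xs

≤-lit : ∀ {m n} {_ : T (m ≤ᵇ n)} → m ≤ n
≤-lit {m} {n} {m≤ᵇn} = ≤ᵇ⇒≤ m n m≤ᵇn

%-injective-window : ∀ {a b} r .{{_ : NonZero r}} → a ≤ b → b < a + r → a % r ≡ b % r → a ≡ b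
%-injective-window {a} {b} r a≤b b<a+r eq with <-cmp (a / r) (b / r)
... | tri≈ _ a/r≡b/r _ = begin
  a                 ≡⟨ m≡m%n+[m/n]*n a r ⟩
  a % r + a / r * r ≡⟨ cong₂ (λ x q → x + q * r) eq a/r≡b/r ⟩
  b % r + b / r * r ≡⟨ m≡m%n+[m/n]*n b r ⟨
  b                 ∎
  where open ≡-Reasoning
... | tri< a/r<b/r _ _ = ⊥-elim (<⇒≱ b<a+r (begin
  a + r                   ≡⟨ cong (_+ r) (m≡m%n+[m/n]*n a r) ⟩
  a % r + a / r * r + r   ≡⟨ +-assoc (a % r) _ r ⟩
  a % r + (a / r * r + r) ≡⟨ cong₂ _+_ eq (+-comm (a / r * r) r) ⟩
  b % r + suc (a / r) * r ≤⟨ +-monoʳ-≤ (b % r) (*-monoˡ-≤ r a/r<b/r) ⟩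
  b % r + b / r * r       ≡⟨ m≡m%n+[m/n]*n b r ⟨
  b                       ∎))
  where open ≤-Reasoning
... | tri> _ _ b/r<a/r = ⊥-elim (<⇒≱ b/r<a/r (/-monoˡ-≤ r a≤b))

module _ {m : ℕ} where

  wrap : ℕ → Fin (suc m)
  wrap j = fromℕ< (m%n<n j (suc m))

  wrap-% : ∀ i j → i % suc m ≡ j % suc m → wrap i ≡ wrap j
  wrap-% _ _ eq = toℕ-injective (trans (toℕ-fromℕ< _) (trans eq (sym (toℕ-fromℕ< _))))

  %-wrap : ∀ i j → wrap i ≡ wrap j → i % suc m ≡ j % suc m
  %-wrap _ _ eq = trans (sym (toℕ-fromℕ< _)) (trans (cong toℕ eq) (toℕ-fromℕ< _))

  wrap-toℕ : ∀ i → wrap (toℕ i) ≡ i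
  wrap-toℕ i = toℕ-injective (trans (toℕ-fromℕ< _) (m<n⇒m%n≡m (toℕ<n i)))

  wrap-period : ∀ j → wrap (j + suc m) ≡ wrap j
  wrap-period j = wrap-% (j + suc m) j ([m+n]%n≡m%n j (suc m))

  sucMod-wrap : ∀ j → sucMod (wrap j) ≡ wrap (suc j)
  sucMod-wrap j = wrap-% (suc (toℕ (wrap j))) (suc j) (begin
    suc (toℕ (wrap j)) % suc m                  ≡⟨ cong (λ x → suc x % suc m) (toℕ-fromℕ< _) ⟩
    suc (j % suc m) % suc m                     ≡⟨ [m+kn]%n≡m%n (suc (j % suc m)) (j / suc m) (suc m) ⟨
    suc (j % suc m + j / suc m * suc m) % suc m ≡⟨ cong (λ x → suc x % suc m) (m≡m%n+[m/n]*n j (suc m)) ⟨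
    suc j % suc m                               ∎)
    where open ≡-Reasoning

  private
    wrap-injective-≤ : ∀ {p q} t → p ≤ q → q < suc m → wrap (p + t) ≡ wrap (q + t) → p ≡ q
    wrap-injective-≤ {p} {q} t p≤q q<r eq =
      +-cancelʳ-≡ t p q (%-injective-window (suc m) (+-monoˡ-≤ t p≤q) q+t<p+t+r (%-wrap (p + t) (q + t) eq))
      where
      q+t<p+t+r : q + t < p + t + suc m
      q+t<p+t+r = subst (q + t <_) (sym (xy∙z≈xz∙y p t (suc m)))
                    (+-monoˡ-< t (<-≤-trans q<r (m≤n+m (suc m) p)))

  wrap-injective-window : ∀ {p q} t → p < suc m → q < suc m → wrap (p + t) ≡ wrap (q + t) → p ≡ q
  wrap-injective-window {p} {q} t p<r q<r eq with ≤-total p q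
  ... | inj₁ p≤q = wrap-injective-≤ t p≤q q<r eq
  ... | inj₂ q≤p = sym (wrap-injective-≤ t q≤p p<r (sym eq))

record RainbowPath {n} (a : Fin n → Fin n → Bool) (c : Coloring n) (ℓ : ℕ) (s : ℕ → Fin n) : Set where
  field
    injective : ∀ {p q} → p < ℓ → q < ℓ → s p ≡ s q → p ≡ q
    adjacent  : ∀ {j} → suc j < ℓ → T (a (s j) (s (suc j)))
    rainbow   : ∀ {p q} → suc p < ℓ → suc q < ℓ → c (s p) (s (suc p)) ≡ c (s q) (s (suc q)) → p ≡ q

module _ {n} {a : Fin n → Fin n → Bool} {c : Coloring n} where

  reverse : ∀ {k s} → (∀ x y → a x y ≡ a y x) → SymmetricColoring c →
            RainbowPath a c (suc k) s → RainbowPath a c (suc k) (λ j → s (k ∸ j))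
  reverse {k} {s} a-sym c-sym P = record
    { injective = λ {p} {q} p<ℓ q<ℓ eq →
        ∸-cancelˡ-≡ (≤-pred p<ℓ) (≤-pred q<ℓ) (injective (s≤s (m∸n≤m k p)) (s≤s (m∸n≤m k q)) eq)
    ; adjacent  = λ {j} j<k →
        subst T (trans (a-sym _ _) (sym (at-reversed-edge (≤-pred j<k) a))) (adjacent (edge<ℓ (≤-pred j<k)))
    ; rainbow   = λ {p} {q} p<k q<k eq → suc-injective (∸-cancelˡ-≡ (≤-pred p<k) (≤-pred q<k)
        (rainbow (edge<ℓ (≤-pred p<k)) (edge<ℓ (≤-pred q<k)) (begin
          c (s (k ∸ suc p)) (s (suc (k ∸ suc p))) ≡⟨ c-sym _ _ ⟩
          c (s (suc (k ∸ suc p))) (s (k ∸ suc p)) ≡⟨ at-reversed-edge (≤-pred p<k) c ⟨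
          c (s (k ∸ p)) (s (k ∸ suc p))           ≡⟨ eq ⟩
          c (s (k ∸ q)) (s (k ∸ suc q))           ≡⟨ at-reversed-edge (≤-pred q<k) c ⟩
          c (s (suc (k ∸ suc q))) (s (k ∸ suc q)) ≡⟨ c-sym _ _ ⟩
          c (s (k ∸ suc q)) (s (suc (k ∸ suc q))) ∎)))
    }
    where
    open RainbowPath P
    open ≡-Reasoning
    edge-index : ∀ {j} → j < k → suc (k ∸ suc j) ≡ k ∸ j
    edge-index j<k = sym (+-∸-assoc 1 j<k)
    edge<ℓ : ∀ {j} → j < k → suc (k ∸ suc j) < suc k
    edge<ℓ {j} j<k = s≤s (subst (_≤ k) (sym (edge-index j<k)) (m∸n≤m k j))
    at-reversed-edge : ∀ {B : Set} {j} → j < k → (f : Fin n → Fin n → B) →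
                       f (s (k ∸ j)) (s (k ∸ suc j)) ≡ f (s (suc (k ∸ suc j))) (s (k ∸ suc j))
    at-reversed-edge {j = j} j<k f = cong (λ i → f (s i) (s (k ∸ suc j))) (sym (edge-index j<k))

  cycle⇒path : ∀ {m} (C : HasRainbowCycle m a c) (t : ℕ) →
               RainbowPath a c (suc m) (λ j → proj₁ C (wrap (j + t)))
  cycle⇒path (f , f-injective , f-adjacent , f-rainbow) t = record
    { injective = λ p<r q<r eq → wrap-injective-window t p<r q<r (f-injective eq)
    ; adjacent  = λ {j} _ → subst (λ i → T (a (f (wrap (j + t))) (f i))) (sucMod-wrap (j + t)) (f-adjacent _)
    ; rainbow   = λ {p} {q} p<r q<r eq →
        wrap-injective-window t (<-trans (n<1+n p) p<r) (<-trans (n<1+n q) q<r)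
          (f-rainbow (trans (colour-at (p + t)) (trans eq (sym (colour-at (q + t))))))
    }
    where
    colour-at : ∀ j → c (f (wrap j)) (f (sucMod (wrap j))) ≡ c (f (wrap j)) (f (wrap (suc j)))
    colour-at j = cong (λ i → c (f (wrap j)) (f i)) (sucMod-wrap j)

module NewEdge {n} (a : Fin n → Fin n → Bool) (c : Coloring n) (u v : Fin n) (k : ℕ) where

  samePair-sound : ∀ x y → T (samePair u v x y) → (x ≡ u × y ≡ v) ⊎ (x ≡ v × y ≡ u)
  samePair-sound x y t with Equivalence.to (T-∨ {⌊ x ≟ u ⌋ ∧ ⌊ y ≟ v ⌋}) t
  ... | inj₁ t₁ = let x≡u , y≡v = Equivalence.to (T-∧ {⌊ x ≟ u ⌋}) t₁
                  in inj₁ (toWitness x≡u , toWitness y≡v)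
  ... | inj₂ t₂ = let x≡v , y≡u = Equivalence.to (T-∧ {⌊ x ≟ v ⌋}) t₂
                  in inj₂ (toWitness x≡v , toWitness y≡u)

  samePair-reversed : T (samePair u v v u)
  samePair-reversed with v ≟ v | u ≟ u
  ... | yes _   | yes _   = subst T (sym (∨-zeroʳ _)) tt
  ... | no v≢v  | _       = ⊥-elim (v≢v refl)
  ... | yes _   | no u≢u  = ⊥-elim (u≢u refl)

  samePair-absent : ∀ x {y} → y ≢ u → y ≢ v → ¬ T (samePair u v x y)
  samePair-absent x {y} y≢u y≢v t with samePair-sound x y t
  ... | inj₁ (_ , y≡v) = y≢v y≡v
  ... | inj₂ (_ , y≡u) = y≢u y≡u

  samePair-sym : ∀ x y → samePair u v x y ≡ samePair u v y x
  samePair-sym x y =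
    trans (∨-comm (⌊ x ≟ u ⌋ ∧ ⌊ y ≟ v ⌋) _) (cong₂ _∨_ (∧-comm ⌊ x ≟ v ⌋ _) (∧-comm ⌊ x ≟ u ⌋ _))

  addEdge-old : ∀ {x y} → ¬ T (samePair u v x y) → T (addEdge a u v x y) → T (a x y)
  addEdge-old {x} {y} old t with Equivalence.to (T-∨ {a x y}) t
  ... | inj₁ t₁ = t₁
  ... | inj₂ t₂ = ⊥-elim (old t₂)

  addColor-old : ∀ {x y} → ¬ T (samePair u v x y) → addColor c u v k x y ≡ c x y
  addColor-old {x} {y} old with samePair u v x y
  ... | true  = ⊥-elim (old tt)
  ... | false = refl

  addColor-new : ∀ {x y} → T (samePair u v x y) → addColor c u v k x y ≡ k
  addColor-new {x} {y} new with samePair u v x y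
  ... | true = refl

  addEdge-sym : (∀ x y → a x y ≡ a y x) → ∀ x y → addEdge a u v x y ≡ addEdge a u v y x
  addEdge-sym a-sym x y = cong₂ _∨_ (a-sym x y) (samePair-sym x y)

  addColor-sym : SymmetricColoring c → SymmetricColoring (addColor c u v k)
  addColor-sym c-sym x y = cong₂ (λ b z → if b then k else z) (samePair-sym x y) (c-sym x y)

  uses-new-edge : ∀ {m} → ¬ HasRainbowCycle m a c →
                  (C : HasRainbowCycle m (addEdge a u v) (addColor c u v k)) →
                  ∃ λ i → T (samePair u v (proj₁ C i) (proj₁ C (sucMod i)))
  uses-new-edge no-cycle (f , f-injective , f-adjacent , f-rainbow)
    with any? (λ i → T? (samePair u v (f i) (f (sucMod i))))
  ... | yes found = found
  ... | no none   = ⊥-elim (no-cycle (f , f-injective , (λ i → addEdge-old (old i) (f-adjacent i)) ,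
      λ {i} {j} eq → f-rainbow (trans (addColor-old (old i)) (trans eq (sym (addColor-old (old j)))))))
    where
    old : ∀ i → ¬ T (samePair u v (f i) (f (sucMod i)))
    old i new = none (i , new)

-- The vertices v, u, p₂, p₃, p₄ of a rainbow cycle of G + uv through the new edge uv coloured k.
record Trace {n} (G : SimpleGraph n) (c : Coloring n) (u v : Fin n) (k : ℕ) : Set where
  field
    p₂ p₃ p₄ : Fin n
    distinct : Unique (v ∷ u ∷ p₂ ∷ p₃ ∷ p₄ ∷ [])
    u~p₂     : T (adj G u p₂)
    p₂~p₃    : T (adj G p₂ p₃)
    p₃~p₄    : T (adj G p₃ p₄)
    fresh    : c u p₂ ≢ k

  v≢p₂ : v ≢ p₂
  v≢p₂ with (_ ∷ v≢p₂ ∷ _) ∷ _ ← distinct = v≢p₂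

  v≢p₃ : v ≢ p₃
  v≢p₃ with (_ ∷ _ ∷ v≢p₃ ∷ _) ∷ _ ← distinct = v≢p₃

  u≢p₃ : u ≢ p₃
  u≢p₃ with _ ∷ (_ ∷ u≢p₃ ∷ _) ∷ _ ← distinct = u≢p₃

module _ {n} {G : SimpleGraph n} {c : Coloring n} where

  path⇒trace : ∀ {u v k ℓ s} → RainbowPath (addEdge (adj G) u v) (addColor c u v k) ℓ s → 5 ≤ ℓ →
               s 0 ≡ v → s 1 ≡ u → Trace G c u v k
  path⇒trace {k = k} {ℓ} {s} P 5≤ℓ refl refl = record
    { p₂       = s 2
    ; p₃       = s 3
    ; p₄       = s 4
    ; distinct = tabulate⁺ {f = s ∘ toℕ} λ eq →
        toℕ-injective (injective (early (toℕ<n _)) (early (toℕ<n _)) eq)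
    ; u~p₂     = old-edge 1 ≤-lit ≤-lit
    ; p₂~p₃    = old-edge 2 ≤-lit ≤-lit
    ; p₃~p₄    = old-edge 3 ≤-lit ≤-lit
    ; fresh    = λ eq → 0≢1+n (rainbow (early ≤-lit) (early ≤-lit) (begin
        addColor c (s 1) (s 0) k (s 0) (s 1) ≡⟨ addColor-new samePair-reversed ⟩
        k                                    ≡⟨ eq ⟨
        c (s 1) (s 2)                        ≡⟨ addColor-old (avoids (s 1) 2 ≤-lit ≤-lit) ⟨
        addColor c (s 1) (s 0) k (s 1) (s 2) ∎))
    }
    where
    open RainbowPath P
    open NewEdge (adj G) c (s 1) (s 0) k
    open ≡-Reasoning
    early : ∀ {j} → j < 5 → j < ℓ
    early j<5 = <-≤-trans j<5 5≤ℓ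
    avoids : ∀ x j → 2 ≤ j → j < 5 → ¬ T (samePair (s 1) (s 0) x (s j))
    avoids x j 2≤j j<5 = samePair-absent x
      (λ eq → <⇒≢ 2≤j (sym (injective (early j<5) (early ≤-lit) eq)))
      (λ eq → <⇒≢ (<-trans ≤-lit 2≤j) (sym (injective (early j<5) (early ≤-lit) eq)))
    old-edge : ∀ j → 1 ≤ j → j < 4 → T (adj G (s j) (s (suc j)))
    old-edge j 1≤j j<4 = addEdge-old (avoids (s j) (suc j) (s≤s 1≤j) (s≤s j<4)) (adjacent (early (s≤s j<4)))

  new-cycle⇒trace : ∀ {m u v k} → 5 ≤ suc m → SymmetricColoring c → ¬ HasRainbowCycle m (adj G) c →
                    HasRainbowCycle m (addEdge (adj G) u v) (addColor c u v k) → Trace G c u v k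
  new-cycle⇒trace {zero} (s≤s ())
  new-cycle⇒trace {suc m} {u} {v} {k} 5≤r c-sym no-cycle C@(f , _) =
    trace-through (uses-new-edge no-cycle C)
    where
    open NewEdge (adj G) c u v k
    swap-ends : ∀ p q → p + suc (suc q) ≡ q + suc (suc p)
    swap-ends p q = trans (+-comm p (suc (suc q))) (sym (trans (+-suc q (suc p)) (cong suc (+-suc q p))))
    trace-through : (∃ λ i → T (samePair u v (f i) (f (sucMod i)))) → Trace G c u v k
    trace-through (i , on-new-edge) with samePair-sound (f i) (f (sucMod i)) on-new-edge
    ... | inj₂ (fi≡v , fi⁺≡u) =
          path⇒trace (cycle⇒path C (toℕ i)) 5≤r (trans (cong f (wrap-toℕ i)) fi≡v) fi⁺≡u
    -- The cycle crosses uv from u to v: read backwards the path of length r starting at index i + 2.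
    ... | inj₁ (fi≡u , fi⁺≡v) = path⇒trace
          (reverse (addEdge-sym (adj-sym G)) (addColor-sym c-sym) (cycle⇒path C (2 + toℕ i))) 5≤r
          (trans (cong f (trans (cong (wrap ∘ suc) (swap-ends m (toℕ i))) (wrap-period (suc (toℕ i))))) fi⁺≡v)
          (trans (cong f (trans (cong wrap (swap-ends m (toℕ i))) (trans (wrap-period (toℕ i)) (wrap-toℕ i))))
                 fi≡u)

module _ {n} (G : SimpleGraph n) where

  neighbours : Fin n → List (Fin n)
  neighbours x = filterᵇ (adj G x) (allFin n)

  degree : Fin n → ℕ
  degree x = length (neighbours x)

module Adjacency {n} (G : SimpleGraph n) where

  infix 4 _~_
  _~_ : Fin n → Fin n → Set
  x ~ y = T (adj G x y)

  ∈-neighbours⁺ : ∀ {x y} → x ~ y → y ∈ neighbours G x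
  ∈-neighbours⁺ {x} {y} x~y = ∈-filter⁺ (λ y → T? (adj G x y)) (∈-allFin y) x~y

  ∈-neighbours⁻ : ∀ {x y} → y ∈ neighbours G x → x ~ y
  ∈-neighbours⁻ {x} y∈N = proj₂ (∈-filter⁻ (λ y → T? (adj G x y)) {xs = allFin n} y∈N)

  neighbours-unique : ∀ x → Unique (neighbours G x)
  neighbours-unique x = filter⁺ (λ y → T? (adj G x y)) (allFin⁺ n)

  ~-irrefl : ∀ {x} → ¬ x ~ x
  ~-irrefl {x} x~x = subst T (irrefl G x) x~x

  ~-sym : ∀ {x y} → x ~ y → y ~ x
  ~-sym {x} {y} = subst T (adj-sym G x y)

  neighbours-exactly : ∀ {x ys} → Unique ys → All (x ~_) ys → degree G x ≡ length ys → neighbours G x ⊆ ys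
  neighbours-exactly ys! x~ys deg = ⊆-by-length _≟_ ys! (∈-neighbours⁺ ∘ All.lookup x~ys) (≤-reflexive deg)

  neighbours-extend : ∀ {x ys} → Unique ys → All (x ~_) ys → degree G x ≡ suc (length ys) →
                      ∃ λ z → z ∉ ys × x ~ z × neighbours G x ⊆ z ∷ ys
  neighbours-extend {x} {ys} ys! x~ys deg
    with z , z∈N , z∉ys ← ∃∈∉ _≟_ (neighbours-unique x) (subst (length ys <_) (sym deg) ≤-refl)
    = z , z∉ys , ∈-neighbours⁻ z∈N ,
      neighbours-exactly (¬Any⇒All¬ ys z∉ys ∷ ys!) (∈-neighbours⁻ z∈N ∷ x~ys) deg

outside : ∀ {n} (ys : List (Fin n)) → length ys < n → ∃ λ v → v ∉ ys
outside {n} ys ys<n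
  with v , _ , v∉ys ← ∃∈∉ _≟_ (allFin⁺ n) (subst (length ys <_) (sym (length-tabulate _)) ys<n)
  = v , v∉ys

Escapes : ∀ {n} → SimpleGraph n → Coloring n → Set
Escapes G c = ∀ {u v} → u ≢ v → ¬ T (adj G u v) → ∀ k → Trace G c u v k

saturated⇒escapes : ∀ {n m} {G : SimpleGraph n} {c : Coloring n} → 5 ≤ suc m → SymmetricColoring c →
                    RainbowSaturated m G c → Escapes G c
saturated⇒escapes {G = G} 5≤r c-sym (no-cycle , saturated) {u} {v} u≢v u≁v k =
  new-cycle⇒trace 5≤r c-sym no-cycle (saturated u v u≢v (¬-not (u≁v ∘ Equivalence.from T-≡)) k)

module LocalStructure {n} {G : SimpleGraph n} {c : Coloring n} (escapes : Escapes G c) where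

  open Adjacency G

  another-neighbour : ∀ {x y v} → v ≢ x → v ≢ y → ∃ λ w → x ~ w × w ≢ y
  another-neighbour {x} {y} {v} v≢x v≢y with T? (adj G x v)
  ... | yes x~v = v , x~v , v≢y
  ... | no x≁v  = p₂ , u~p₂ , fresh ∘ cong (c x)
    where open Trace (escapes (v≢x ∘ sym) x≁v (c x y))

  degree≥2 : 3 ≤ n → ∀ x → 2 ≤ degree G x
  degree≥2 3≤n x
    with v₁ , v₁∉[x] ← outside (x ∷ []) (≤-trans ≤-lit 3≤n)
    with w₁ , x~w₁ , _ ← another-neighbour (v₁∉[x] ∘ here) (v₁∉[x] ∘ here)
    with v₂ , v₂∉[x,w₁] ← outside (x ∷ w₁ ∷ []) 3≤n
    with w₂ , x~w₂ , w₂≢w₁ ← another-neighbour (v₂∉[x,w₁] ∘ here) (v₂∉[x,w₁] ∘ there ∘ here)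
    = Unique⇒length≤ ((w₂≢w₁ ∘ sym ∷ []) ∷ [] ∷ []) (∈-neighbours⁺ ∘ All.lookup (x~w₁ ∷ x~w₂ ∷ []))

  -- Were the other neighbour a′ of a not b, the trace from x to a′ avoiding colour c x b would have
  -- to enter a, from where it cannot continue.
  deg2-pair-triangle : ∀ {x a b} → x ~ a → neighbours G x ⊆ a ∷ b ∷ [] → degree G a ≡ 2 →
                       a ~ b × neighbours G a ⊆ b ∷ x ∷ []
  deg2-pair-triangle {x} {a} {b} x~a Nx⊆ab deg-a
    with a′ , a′∉[x] , a~a′ , Na⊆a′x ← neighbours-extend ([] ∷ []) (~-sym x~a ∷ []) deg-a
    with a′ ≟ b
  ... | yes refl = a~a′ , Na⊆a′x
  ... | no a′≢b  = ⊥-elim (leaves (Nx⊆ab (∈-neighbours⁺ u~p₂)))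
    where
    x≁a′ : ¬ x ~ a′
    x≁a′ x~a′ with Nx⊆ab (∈-neighbours⁺ x~a′)
    ... | here a′≡a         = ~-irrefl (subst (_~ a′) (sym a′≡a) a~a′)
    ... | there (here a′≡b) = a′≢b a′≡b
    open Trace (escapes (a′∉[x] ∘ here ∘ sym) x≁a′ (c x b))
    leaves : p₂ ∉ a ∷ b ∷ []
    leaves (here p₂≡a) with Na⊆a′x (∈-neighbours⁺ (subst (_~ p₃) p₂≡a p₂~p₃))
    ... | here p₃≡a′        = v≢p₃ (sym p₃≡a′)
    ... | there (here p₃≡x) = u≢p₃ (sym p₃≡x)
    leaves (there (here p₂≡b)) = fresh (cong (c x) p₂≡b)

  -- The five distinct vertices of the trace all lie in v ∷ S.
  trapped : ∀ {x v k S} → Trace G c x v k → x ∈ S → (∀ {w} → w ∈ S → neighbours G w ⊆ v ∷ S) →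
            4 ≤ length S
  trapped {v = v} {S = S} t x∈S closed =
    ≤-pred (Unique⇒length≤ distinct
      (All.lookup (here refl ∷ there x∈S ∷ there p₂∈S ∷ there p₃∈S ∷ p₄∈ ∷ [])))
    where
    open Trace t
    step : ∀ {w y} → w ∈ S → w ~ y → y ∈ v ∷ S
    step w∈S w~y = closed w∈S (∈-neighbours⁺ w~y)
    beyond : ∀ {y} → y ∈ v ∷ S → v ≢ y → y ∈ S
    beyond (here y≡v)  v≢y = ⊥-elim (v≢y (sym y≡v))
    beyond (there y∈S) _   = y∈S
    p₂∈S = beyond (step x∈S u~p₂) v≢p₂
    p₃∈S = beyond (step p₂∈S p₂~p₃) v≢p₃
    p₄∈ = step p₃∈S p₃~p₄

  closed₃ : ∀ {v x a b} → let S = x ∷ a ∷ b ∷ [] in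
            neighbours G x ⊆ v ∷ S → neighbours G a ⊆ v ∷ S → neighbours G b ⊆ v ∷ S →
            ∀ {w} → w ∈ S → neighbours G w ⊆ v ∷ S
  closed₃ Nx Na Nb (here refl)                 = Nx
  closed₃ Nx Na Nb (there (here refl))         = Na
  closed₃ Nx Na Nb (there (there (here refl))) = Nb

  -- Otherwise x, a, b form a triangle of degree-2 vertices, which traps any trace from x.
  deg2-neighbours-not-both-deg2 : 4 ≤ n → ∀ {x a b} → x ~ a → x ~ b → neighbours G x ⊆ a ∷ b ∷ [] →
                                  degree G a ≡ 2 → degree G b ≡ 2 → ⊥
  deg2-neighbours-not-both-deg2 4≤n {x} {a} {b} x~a x~b Nx⊆ab deg-a deg-b
    with _ , Na⊆bx ← deg2-pair-triangle x~a Nx⊆ab deg-a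
    with _ , Nb⊆ax ← deg2-pair-triangle x~b (∈-swap ∘ Nx⊆ab) deg-b
    with v , v∉xab ← outside (x ∷ a ∷ b ∷ []) 4≤n
    = <-irrefl refl (trapped (escapes (v∉xab ∘ here ∘ sym) (v∉xab ∘ there ∘ Nx⊆ab ∘ ∈-neighbours⁺) 0)
        (here refl)
        (closed₃ (All.lookup (a∈ ∷ b∈ ∷ []) ∘ Nx⊆ab) (All.lookup (b∈ ∷ x∈ ∷ []) ∘ Na⊆bx)
                 (All.lookup (a∈ ∷ x∈ ∷ []) ∘ Nb⊆ax)))
    where
    x∈ = there (here refl)
    a∈ = there (there (here refl))
    b∈ = there (there (there (here refl)))

  -- y, a and x form a triangle that traps the trace from y to the third neighbour z of x.
  deg3-not-next-to-deg2-pair : ∀ {x y a} → degree G x ≡ 3 → x ~ y → degree G y ≡ 2 →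
                               y ~ a → degree G a ≡ 2 → ⊥
  deg3-not-next-to-deg2-pair {x} {y} {a} deg-x x~y deg-y y~a deg-a =
    let a~x , Na⊆xy           = deg2-pair-triangle y~a Ny⊆ax deg-a
        z , z∉ya , x~z , Nx⊆zya = neighbours-extend ((y≢a ∷ []) ∷ [] ∷ []) (x~y ∷ ~-sym a~x ∷ []) deg-x
    in <-irrefl refl (trapped (escapes (z∉ya ∘ here ∘ sym) (y≁z z∉ya x~z) 0) (here refl)
         (closed₃ (All.lookup (a∈ ∷ x∈ ∷ []) ∘ Ny⊆ax) (All.lookup (x∈ ∷ y∈ ∷ []) ∘ Na⊆xy)
                  (All.lookup (here refl ∷ y∈ ∷ a∈ ∷ []) ∘ Nx⊆zya)))
    where
    y≢a : y ≢ a
    y≢a refl = ~-irrefl y~a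
    a≢x : a ≢ x
    a≢x refl = 1+n≢n (trans (sym deg-x) deg-a)
    Ny⊆ax : neighbours G y ⊆ a ∷ x ∷ []
    Ny⊆ax = neighbours-exactly ((a≢x ∷ []) ∷ [] ∷ []) (y~a ∷ ~-sym x~y ∷ []) deg-y
    y≁z : ∀ {z} → z ∉ y ∷ a ∷ [] → x ~ z → ¬ y ~ z
    y≁z z∉ya x~z y~z with Ny⊆ax (∈-neighbours⁺ y~z)
    ... | here z≡a         = z∉ya (there (here z≡a))
    ... | there (here z≡x) = ~-irrefl (subst (x ~_) z≡x x~z)
    y∈ = there (here refl)
    a∈ = there (there (here refl))
    x∈ = there (there (there (here refl)))

∑≥ : ∀ {n k} (f : Fin n → ℕ) → (∀ i → k ≤ f i) → n * k ≤ ∑[ i < n ] f i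
∑≥ {zero}  f k≤f = z≤n
∑≥ {suc n} f k≤f = +-mono-≤ (k≤f zero) (∑≥ (f ∘ suc) (k≤f ∘ suc))

sum-tabulate : ∀ {n} (f : Fin n → ℕ) → sum (tabulate f) ≡ ∑[ i < n ] f i
sum-tabulate {zero}  f = refl
sum-tabulate {suc n} f = cong (f zero +_) (sum-tabulate (f ∘ suc))

sum-map-allFin : ∀ {n} (f : Fin n → ℕ) → sum (map f (allFin n)) ≡ ∑[ i < n ] f i
sum-map-allFin f = trans (cong sum (map-tabulate id f)) (sum-tabulate f)

module _ {n} (G : SimpleGraph n) where

  private
    upper : Fin n → Fin n → ℕ
    upper i j = if (toℕ i <ᵇ toℕ j) ∧ adj G i j then 1 else 0

    indicator : Bool → ℕ
    indicator b = if b then 1 else 0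

  numEdges≡∑∑ : numEdges G ≡ ∑[ i < n ] ∑[ j < n ] upper i j
  numEdges≡∑∑ = trans (sum-map-allFin (λ i → sum (map (upper i) (allFin n))))
                      (sum-cong-≗ (λ i → sum-map-allFin (upper i)))

  upper+upper : ∀ i j → upper i j + upper j i ≡ indicator (adj G i j)
  upper+upper i j with toℕ i <ᵇ toℕ j in i<j | toℕ j <ᵇ toℕ i in j<i
  ... | true  | true  =
    ⊥-elim (<-asym (<ᵇ⇒< (toℕ i) (toℕ j) (subst T (sym i<j) _)) (<ᵇ⇒< (toℕ j) (toℕ i) (subst T (sym j<i) _)))
  ... | true  | false = +-identityʳ _
  ... | false | true  = cong indicator (adj-sym G j i)
  ... | false | false = cong indicator (sym (trans (cong (adj G i) (sym i≡j)) (irrefl G i)))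
    where
    ≮ : ∀ {p q} → (p <ᵇ q) ≡ false → ¬ p < q
    ≮ {p} {q} p≮q p<q = subst T p≮q (<⇒<ᵇ p<q)
    i≡j : i ≡ j
    i≡j = toℕ-injective (≤-antisym (≮⇒≥ (≮ {toℕ j} j<i)) (≮⇒≥ (≮ {toℕ i} i<j)))

  ∑∑-shares : (s : Fin n → Fin n → ℕ) (K : ℕ) → (∀ {x y} → T (adj G x y) → s x y + s y x ≡ K) →
              ∑[ x < n ] ∑[ y < n ] (if adj G x y then s x y else 0) ≡ K * numEdges G
  ∑∑-shares s K balanced = begin
    ∑[ x < n ] ∑[ y < n ] (if adj G x y then s x y else 0)
      ≡⟨ ∑∑-cong split ⟩
    ∑[ x < n ] ∑[ y < n ] (upper x y * s x y + upper y x * s x y)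
      ≡⟨ ∑∑-distrib-+ (λ x y → upper x y * s x y) (λ x y → upper y x * s x y) ⟩
    ∑[ x < n ] ∑[ y < n ] (upper x y * s x y) + ∑[ x < n ] ∑[ y < n ] (upper y x * s x y)
      ≡⟨ cong (∑[ x < n ] ∑[ y < n ] (upper x y * s x y) +_) (∑-comm (λ x y → upper y x * s x y)) ⟩
    ∑[ x < n ] ∑[ y < n ] (upper x y * s x y) + ∑[ x < n ] ∑[ y < n ] (upper x y * s y x)
      ≡⟨ ∑∑-distrib-+ (λ x y → upper x y * s x y) (λ x y → upper x y * s y x) ⟨
    ∑[ x < n ] ∑[ y < n ] (upper x y * s x y + upper x y * s y x)
      ≡⟨ ∑∑-cong (λ x y → trans (sym (*-distribˡ-+ (upper x y) (s x y) (s y x))) (collect x y)) ⟩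
    ∑[ x < n ] ∑[ y < n ] (K * upper x y)
      ≡⟨ ∑∑-scale upper ⟩
    K * ∑[ x < n ] ∑[ y < n ] upper x y
      ≡⟨ cong (K *_) numEdges≡∑∑ ⟨
    K * numEdges G
      ∎
    where
    open ≡-Reasoning
    ∑∑-cong : ∀ {f g : Fin n → Fin n → ℕ} → (∀ x y → f x y ≡ g x y) →
              ∑[ x < n ] ∑[ y < n ] f x y ≡ ∑[ x < n ] ∑[ y < n ] g x y
    ∑∑-cong f≡g = sum-cong-≗ (λ x → sum-cong-≗ (f≡g x))
    ∑∑-distrib-+ : ∀ (f g : Fin n → Fin n → ℕ) → ∑[ x < n ] ∑[ y < n ] (f x y + g x y) ≡
                   ∑[ x < n ] ∑[ y < n ] f x y + ∑[ x < n ] ∑[ y < n ] g x y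
    ∑∑-distrib-+ f g = trans (sum-cong-≗ (λ x → ∑-distrib-+ (f x) (g x)))
                             (∑-distrib-+ (λ x → ∑[ y < n ] f x y) (λ x → ∑[ y < n ] g x y))
    ∑∑-scale : ∀ (f : Fin n → Fin n → ℕ) →
               ∑[ x < n ] ∑[ y < n ] (K * f x y) ≡ K * ∑[ x < n ] ∑[ y < n ] f x y
    ∑∑-scale f = sym (trans (*-distribˡ-sum K (λ x → ∑[ y < n ] f x y))
                            (sum-cong-≗ (λ x → *-distribˡ-sum K (f x))))
    indicator-* : ∀ b t → indicator b * t ≡ (if b then t else 0)
    indicator-* true  t = +-identityʳ t
    indicator-* false t = refl
    split : ∀ x y → (if adj G x y then s x y else 0) ≡ upper x y * s x y + upper y x * s x y
    split x y = sym (begin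
      upper x y * s x y + upper y x * s x y ≡⟨ *-distribʳ-+ (s x y) (upper x y) (upper y x) ⟨
      (upper x y + upper y x) * s x y       ≡⟨ cong (_* s x y) (upper+upper x y) ⟩
      indicator (adj G x y) * s x y         ≡⟨ indicator-* (adj G x y) (s x y) ⟩
      (if adj G x y then s x y else 0)      ∎)
    collect : ∀ x y → upper x y * (s x y + s y x) ≡ K * upper x y
    collect x y with toℕ x <ᵇ toℕ y | adj G x y in x~y
    ... | true  | true  = trans (+-identityʳ _) (trans (balanced (subst T (sym x~y) _)) (sym (*-identityʳ K)))
    ... | true  | false = sym (*-zeroʳ K)
    ... | false | _     = sym (*-zeroʳ K)

-- The part of the charge 10 of an edge xy that goes to x: x₂ (y₂) says that x (y) has degree 2,
-- x₂-nbr (y₂-nbr) that it has a neighbour of degree 2.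
shareRule : (x₂ y₂ x₂-nbr y₂-nbr : Bool) → ℕ
shareRule true  true  _     _     = 5
shareRule true  false true  _     = 7
shareRule true  false false _     = 6
shareRule false true  _     true  = 3
shareRule false true  _     false = 4
shareRule false false _     _     = 5

module _ {n} (G : SimpleGraph n) where

  deg2? : Fin n → Bool
  deg2? x = ⌊ degree G x ℕ.≟ 2 ⌋

  deg2-neighbour? : Fin n → Bool
  deg2-neighbour? x = any deg2? (neighbours G x)

  share : Fin n → Fin n → ℕ
  share x y = shareRule (deg2? x) (deg2? y) (deg2-neighbour? x) (deg2-neighbour? y)

  charge : Fin n → ℕ
  charge x = sum (map (share x) (neighbours G x))

shareRule-balanced : ∀ x₂ y₂ xn yn → shareRule x₂ y₂ xn yn + shareRule y₂ x₂ yn xn ≡ 10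
shareRule-balanced true  true  _     _     = refl
shareRule-balanced true  false true  _     = refl
shareRule-balanced true  false false _     = refl
shareRule-balanced false true  _     true  = refl
shareRule-balanced false true  _     false = refl
shareRule-balanced false false _     _     = refl

shareRule≥3 : ∀ x₂ y₂ xn yn → 3 ≤ shareRule x₂ y₂ xn yn
shareRule≥3 true  true  _     _     = ≤-lit
shareRule≥3 true  false true  _     = ≤-lit
shareRule≥3 true  false false _     = ≤-lit
shareRule≥3 false true  _     true  = ≤-lit
shareRule≥3 false true  _     false = ≤-lit
shareRule≥3 false false _     _     = ≤-lit

-- Stated in the form that sum and any take on a two-element list.
deg2-shareRule : ∀ a₂ b₂ an bn → ¬ (T a₂ × T b₂) →
                 let x-nbr = a₂ ∨ (b₂ ∨ false) in
                 12 ≤ shareRule true a₂ x-nbr an + (shareRule true b₂ x-nbr bn + 0)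
deg2-shareRule true  true  _ _ not-both = ⊥-elim (not-both _)
deg2-shareRule true  false _ _ _        = ≤-lit
deg2-shareRule false true  _ _ _        = ≤-lit
deg2-shareRule false false _ _ _        = ≤-lit

deg3-shareRule : ∀ y₂ xn yn → (T y₂ → ¬ T yn) → 4 ≤ shareRule false y₂ xn yn
deg3-shareRule true  _ true  isolated = ⊥-elim (isolated _ _)
deg3-shareRule true  _ false _        = ≤-lit
deg3-shareRule false _ _     _        = ≤-lit

deg2?-sound : ∀ {n} (G : SimpleGraph n) x → T (deg2? G x) → degree G x ≡ 2
deg2?-sound G x = toWitness {a? = degree G x ℕ.≟ 2}

∑-charge : ∀ {n} (G : SimpleGraph n) → ∑[ x < n ] charge G x ≡ 10 * numEdges G
∑-charge {n} G = trans
  (sum-cong-≗ (λ x → trans (sum-map-filterᵇ (adj G x) (share G x) (allFin n))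
                           (sum-map-allFin (λ y → if adj G x y then share G x y else 0))))
  (∑∑-shares G (share G) 10 λ {x} {y} _ →
    shareRule-balanced (deg2? G x) (deg2? G y) (deg2-neighbour? G x) (deg2-neighbour? G y))

module Discharging {n} {G : SimpleGraph n} {c : Coloring n} (escapes : Escapes G c) (4≤n : 4 ≤ n) where

  open Adjacency G
  open LocalStructure escapes

  charge-deg2 : ∀ {x a b} → neighbours G x ≡ a ∷ b ∷ [] → 12 ≤ share G x a + (share G x b + 0)
  charge-deg2 {x} {a} {b} Nx≡ab =
    subst (12 ≤_) (sym (cong₂ _+_ (share-at a) (cong (_+ 0) (share-at b))))
      (deg2-shareRule (deg2? G a) (deg2? G b) (deg2-neighbour? G a) (deg2-neighbour? G b)
        λ (a₂ , b₂) →
          deg2-neighbours-not-both-deg2 4≤n x~a x~b Nx⊆ab (deg2?-sound G a a₂) (deg2?-sound G b b₂))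
    where
    share-at : ∀ y → share G x y ≡
               shareRule true (deg2? G y) (deg2? G a ∨ (deg2? G b ∨ false)) (deg2-neighbour? G y)
    share-at y = cong₂ (λ x₂ xn → shareRule x₂ (deg2? G y) xn (deg2-neighbour? G y))
                   (cong (λ L → ⌊ length L ℕ.≟ 2 ⌋) Nx≡ab) (cong (any (deg2? G)) Nx≡ab)
    Nx⊆ab : neighbours G x ⊆ a ∷ b ∷ []
    Nx⊆ab = subst (_ ∈_) Nx≡ab
    x~a = ∈-neighbours⁻ (subst (a ∈_) (sym Nx≡ab) (here refl))
    x~b = ∈-neighbours⁻ (subst (b ∈_) (sym Nx≡ab) (there (here refl)))

  share-deg3 : ∀ {x y} → degree G x ≡ 3 → x ~ y → 4 ≤ share G x y
  share-deg3 {x} {y} deg-x x~y =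
    subst (4 ≤_) (sym share-at) (deg3-shareRule (deg2? G y) (deg2-neighbour? G x) (deg2-neighbour? G y) isolated)
    where
    share-at : share G x y ≡ shareRule false (deg2? G y) (deg2-neighbour? G x) (deg2-neighbour? G y)
    share-at = cong (λ d → shareRule ⌊ d ℕ.≟ 2 ⌋ (deg2? G y) (deg2-neighbour? G x) (deg2-neighbour? G y)) deg-x
    isolated : T (deg2? G y) → ¬ T (deg2-neighbour? G y)
    isolated y₂ y-deg2-nbr with a , a∈Ny , a₂ ← find (any⁻ (deg2? G) (neighbours G y) y-deg2-nbr) =
      deg3-not-next-to-deg2-pair deg-x x~y (deg2?-sound G y y₂) (∈-neighbours⁻ a∈Ny) (deg2?-sound G a a₂)

  charge≥12 : ∀ x → 12 ≤ charge G x
  charge≥12 x = by-neighbours (neighbours G x) refl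
    where
    length≥2 : ∀ {L} → neighbours G x ≡ L → 2 ≤ length L
    length≥2 Nx≡L = subst (2 ≤_) (cong length Nx≡L) (degree≥2 (≤-trans ≤-lit 4≤n) x)
    adjacent : ∀ {L y} → neighbours G x ≡ L → y ∈ L → x ~ y
    adjacent {y = y} Nx≡L y∈L = ∈-neighbours⁻ (subst (y ∈_) (sym Nx≡L) y∈L)
    by-neighbours : ∀ L → neighbours G x ≡ L → 12 ≤ sum (map (share G x) L)
    by-neighbours []                    Nx≡L = ⊥-elim (n≮0 (length≥2 Nx≡L))
    by-neighbours (_ ∷ [])              Nx≡L = ⊥-elim (<-irrefl refl (length≥2 Nx≡L))
    by-neighbours (_ ∷ _ ∷ [])          Nx≡L = charge-deg2 Nx≡L
    by-neighbours (_ ∷ _ ∷ _ ∷ [])      Nx≡L =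
      sum-map-≥ (share G x) (share-deg3 (cong length Nx≡L) ∘ adjacent Nx≡L)
    by-neighbours L@(_ ∷ _ ∷ _ ∷ _ ∷ L′) _ = ≤-trans (m≤m+n 12 (length L′ * 3))
      (sum-map-≥ (share G x) {xs = L} λ {y} _ →
        shareRule≥3 (deg2? G x) (deg2? G y) (deg2-neighbour? G x) (deg2-neighbour? G y))

theorem1p7 : (n m : ℕ) → 6 ≤ suc m → suc m ≤ n →
    (G : SimpleGraph n) (c : Coloring n) → SymmetricColoring c →
    RainbowSaturated m G c → 6 * n ≤ 5 * numEdges G
theorem1p7 n m 6≤r r≤n G c c-sym saturated = *-cancelˡ-≤ 2 (begin
  2 * (6 * n)            ≡⟨ trans (sym (*-assoc 2 6 n)) (*-comm 12 n) ⟩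
  n * 12                 ≤⟨ ∑≥ (charge G) charge≥12 ⟩
  ∑[ x < n ] charge G x  ≡⟨ ∑-charge G ⟩
  10 * numEdges G        ≡⟨ *-assoc 2 5 (numEdges G) ⟩
  2 * (5 * numEdges G)   ∎)
  where
  open ≤-Reasoning
  open Discharging (saturated⇒escapes {m = m} {G} {c} (≤-trans ≤-lit 6≤r) c-sym saturated)
                   (≤-trans ≤-lit (≤-trans 6≤r r≤n))
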